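{- Let $\mathbb{F}_q$ be a finite field and $n\ge3$. Let $f_2\in\mathbb{F}_q[x_3,\ldots,x_n]$ and $g_2\in\mathbb{F}_q[x_3,\ldots,x_n]$ be quadratic forms and $f_3\in\mathbb{F}_q[x_2,\ldots,x_n]$ a cubic form, and set $$f(\mathbf{x})=x_1f_2(\mathbf{x}_3)+f_3(\mathbf{x}_2),\qquad g(\mathbf{x})=x_1x_2+g_2(\mathbf{x}_3),\qquad H(\mathbf{x}_2)=x_2f_3(\mathbf{x}_2)-(f_2g_2)(\mathbf{x}_3),$$ where $\mathbf{x}_i=(x_i,\ldots,x_n)$. If $\mathbf{x}_2\in\mathbb{F}_q^{n-1}$ is a non-singular zero of $H$ (i.e. $H(\mathbf{x}_2)=0$ and $\nabla H(\mathbf{x}_2)\ne\mathbf{0}$) with $x_2\ne0$, then $(-x_2^{ -1}g_2(\mathbf{x}_3),\mathbf{x}_2)\in\mathbb{F}_q^n$ is a non-singular zero of the system $(f,g)$, i.e. $f$ and $g$ vanish there and $\nabla f$, $\nabla g$ are linearly independent there. -}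

module Defs where

open import Level using (Level; _⊔_)
open import Data.Nat using (ℕ; zero; suc)
open import Data.Fin using (Fin; zero; suc)
open import Data.Product using (Σ; ∃; _×_)
open import Relation.Nullary using (¬_)
open import Algebra.Bundles using (CommutativeRing)

record IsFiniteField {c ℓ : Level} (R : CommutativeRing c ℓ) : Set (c ⊔ ℓ) where
  open CommutativeRing R hiding (zero)
  field
    0≉1     : ¬ (0# ≈ 1#)
    inverse : ∀ x → ¬ (x ≈ 0#) → ∃ λ y → x * y ≈ 1#
    size    : ℕ
    enum    : Fin size → Carrier
    enum-onto : ∀ x → ∃ λ i → enum i ≈ x

module Poly {c ℓ : Level} (R : CommutativeRing c ℓ) where
  open CommutativeRing R hiding (zero)

  data Pol (n : ℕ) : Set c where
    con  : Carrier → Pol n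
    var  : Fin n → Pol n
    _⊕_  : Pol n → Pol n → Pol n
    _⊗_  : Pol n → Pol n → Pol n
    ⊝_   : Pol n → Pol n

  infixl 6 _⊕_
  infixl 7 _⊗_

  eval : ∀ {n} → Pol n → (Fin n → Carrier) → Carrier
  eval (con a) x = a
  eval (var i) x = x i
  eval (p ⊕ q) x = eval p x + eval q x
  eval (p ⊗ q) x = eval p x * eval q x
  eval (⊝ p)   x = - eval p x

  δ : ∀ {n} → Fin n → Fin n → Carrier
  δ zero    zero    = 1#
  δ zero    (suc j) = 0#
  δ (suc i) zero    = 0#
  δ (suc i) (suc j) = δ i j

  ∂ : ∀ {n} → Fin n → Pol n → Pol n
  ∂ i (con a) = con 0#
  ∂ i (var j) = con (δ i j)
  ∂ i (p ⊕ q) = ∂ i p ⊕ ∂ i q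
  ∂ i (p ⊗ q) = ∂ i p ⊗ q ⊕ p ⊗ ∂ i q
  ∂ i (⊝ p)   = ⊝ ∂ i p

  rename : ∀ {m n} → (Fin m → Fin n) → Pol m → Pol n
  rename ρ (con a) = con a
  rename ρ (var j) = var (ρ j)
  rename ρ (p ⊕ q) = rename ρ p ⊕ rename ρ q
  rename ρ (p ⊗ q) = rename ρ p ⊗ rename ρ q
  rename ρ (⊝ p)   = ⊝ rename ρ p

  ∑ : ∀ {k n} → (Fin k → Pol n) → Pol n
  ∑ {zero}  t = con 0#
  ∑ {suc k} t = t zero ⊕ ∑ (λ i → t (suc i))

  quadForm : ∀ {m} → (Fin m → Fin m → Carrier) → Pol m
  quadForm a = ∑ λ i → ∑ λ j → con (a i j) ⊗ var i ⊗ var j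

  cubicForm : ∀ {m} → (Fin m → Fin m → Fin m → Carrier) → Pol m
  cubicForm a = ∑ λ i → ∑ λ j → ∑ λ k → con (a i j k) ⊗ var i ⊗ var j ⊗ var k

  GradZero : ∀ {n} → Pol n → (Fin n → Carrier) → Set ℓ
  GradZero {n} p x = ∀ (i : Fin n) → eval (∂ i p) x ≈ 0#

  GradsIndependent : ∀ {n} → Pol n → Pol n → (Fin n → Carrier) → Set (c ⊔ ℓ)
  GradsIndependent {n} p q x =
    ∀ (a b : Carrier) →
      (∀ (i : Fin n) → a * eval (∂ i p) x + b * eval (∂ i q) x ≈ 0#) →
      (a ≈ 0#) × (b ≈ 0#)

  -- Setup of the lemma: n = 2 + m variables x₁,…,xₙ (index 0 is x₁, index 1 is x₂);
  -- f₂, g₂ are quadratic forms in x₃..xₙ (Fin m), f₃ a cubic form in x₂..xₙ (Fin (suc m)).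
  module Setup {m : ℕ}
      (a₂ : Fin m → Fin m → Carrier)
      (b₂ : Fin m → Fin m → Carrier)
      (c₃ : Fin (suc m) → Fin (suc m) → Fin (suc m) → Carrier)
      where
    f₂ g₂ : Pol m
    f₂ = quadForm a₂
    g₂ = quadForm b₂
    f₃ : Pol (suc m)
    f₃ = cubicForm c₃

    f : Pol (suc (suc m))
    f = var zero ⊗ rename (λ i → suc (suc i)) f₂ ⊕ rename suc f₃
    g : Pol (suc (suc m))
    g = var zero ⊗ var (suc zero) ⊕ rename (λ i → suc (suc i)) g₂
    H : Pol (suc m)
    H = var zero ⊗ f₃ ⊕ ⊝ (rename suc f₂ ⊗ rename suc g₂)

    -- the point (−x₂⁻¹ g₂(x₃), x₂) ∈ Fⁿ, given y = x₂ ∈ F^{n−1} and an inverse y₂⁻¹ of its first coordinate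
    liftPoint : (Fin (suc m) → Carrier) → Carrier → Fin (suc (suc m)) → Carrier
    liftPoint y y₂⁻¹ zero    = - (y₂⁻¹ * eval g₂ (λ i → y (suc i)))
    liftPoint y y₂⁻¹ (suc i) = y i

-- g(P) = t x₂ + g₂ = 0 directly, and f(P) = t f₂ + f₃ = 0 since x₂ f₃ = f₂ g₂.  For the
-- gradients, ∂₀g(P) = x₂ is a unit and, using f(P) = g(P) = 0, the 2×2 minors of
-- (∇f, ∇g) against the x₁-column are exactly the partials of H:
--     ∂_{j+1} f(P) · ∂₀ g(P) = ∂₀ f(P) · ∂_{j+1} g(P) + ∂_j H(y).
-- Hence a relation a∇f + b∇g = 0 gives a·∇H(y) = 0, so a = 0 as ∇H(y) ≠ 0, and then b = 0.
module Submission where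

open import Defs
open import Level using (Level)
open import Data.Nat using (ℕ; suc; _≤_)
open import Data.Fin using (Fin; zero; suc)
open import Data.Product using (_×_)
open import Relation.Nullary using (¬_)
open import Algebra.Bundles using (CommutativeRing)

open import Data.Nat as ℕ using (_!; _∸_)
import Data.Nat.Properties as ℕ
open import Data.Nat.Divisibility using (divides; ∣-trans; m∣m*n; m≤n⇒m!∣n!)
import Data.Fin as Fin
import Data.Fin.Properties as Fin
open import Data.Product using (_,_; proj₁; proj₂; ∃)
open import Function using (_∘_)
open import Relation.Binary.PropositionalEquality as ≡ using (_≡_)
import Algebra.Solver.Ring.NaturalCoefficients.Default as NaturalCoefficientSolver

module RingFacts {c ℓ : Level} (R : CommutativeRing c ℓ) where
  open CommutativeRing R hiding (zero)
  open import Algebra.Properties.Ring ring using (-‿+-comm; +-cancelʳ)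
  open import Relation.Binary.Reasoning.Setoid setoid
  open NaturalCoefficientSolver commutativeSemiring using (solve; _:+_; _:*_; _:=_)

  inverse-cancels : ∀ {u v} → u * v ≈ 1# → ∀ x → v * (u * x) ≈ x
  inverse-cancels {u} {v} uv≈1 x = begin
    v * (u * x)  ≈⟨ *-assoc v u x ⟨
    (v * u) * x  ≈⟨ *-congʳ (trans (*-comm v u) uv≈1) ⟩
    1# * x       ≈⟨ *-identityˡ x ⟩
    x            ∎

  unit-cancel : ∀ {u v x y} → u * v ≈ 1# → u * x ≈ u * y → x ≈ y
  unit-cancel {u} {v} {x} {y} uv≈1 ux≈uy = begin
    x            ≈⟨ inverse-cancels uv≈1 x ⟨
    v * (u * x)  ≈⟨ *-congˡ ux≈uy ⟩
    v * (u * y)  ≈⟨ inverse-cancels uv≈1 y ⟩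
    y            ∎

  unit-annihilator : ∀ {u v a} → u * v ≈ 1# → a * u ≈ 0# → a ≈ 0#
  unit-annihilator {u} uv≈1 au≈0 =
    unit-cancel uv≈1 (trans (*-comm u _) (trans au≈0 (sym (zeroʳ u))))

  +-cancel-inner : ∀ u v x → u + (v + - (x + u)) ≈ v + - x
  +-cancel-inner u v x = begin
    u + (v + - (x + u))        ≈⟨ +-congˡ (+-congˡ (-‿+-comm x u)) ⟨
    u + (v + (- x + - u))      ≈⟨ solve 4 (λ u v x′ u′ → u :+ (v :+ (x′ :+ u′)) := (v :+ x′) :+ (u :+ u′))
                                        refl u v (- x) (- u) ⟩
    (v + - x) + (u + - u)      ≈⟨ +-congˡ (-‿inverseʳ u) ⟩
    (v + - x) + 0#             ≈⟨ +-identityʳ _ ⟩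
    v + - x                    ∎

  cross-multiply : ∀ {n} a b (u v : Fin n → Carrier) →
    (∀ k → a * u k + b * v k ≈ 0#) → ∀ k l → a * (u k * v l) ≈ a * (u l * v k)
  cross-multiply a b u v comb k l = +-cancelʳ (b * (v k * v l)) _ _ (begin
      a * (u k * v l) + b * (v k * v l)  ≈⟨ scaled k l ⟩
      0#                                 ≈⟨ scaled l k ⟨
      a * (u l * v k) + b * (v l * v k)  ≈⟨ +-congˡ (*-congˡ (*-comm (v l) (v k))) ⟩
      a * (u l * v k) + b * (v k * v l)  ∎)
    where
    scaled : ∀ k l → a * (u k * v l) + b * (v k * v l) ≈ 0#
    scaled k l = begin
      a * (u k * v l) + b * (v k * v l)  ≈⟨ solve 5 (λ a b x y z → a :* (x :* z) :+ b :* (y :* z) := (a :* x :+ b :* y) :* z)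
                                                  refl a b (u k) (v k) (v l) ⟩
      (a * u k + b * v k) * v l          ≈⟨ *-congʳ (comb k) ⟩
      0# * v l                           ≈⟨ zeroˡ (v l) ⟩
      0#                                 ∎

module PolyCalculus {c ℓ : Level} (R : CommutativeRing c ℓ) where
  open CommutativeRing R hiding (zero)
  open Poly R
  open import Algebra.Properties.Ring ring using (-0#≈0#)

  eval-rename : ∀ {m n} (ρ : Fin m → Fin n) (p : Pol m) (x : Fin n → Carrier) →
                eval (rename ρ p) x ≡ eval p (x ∘ ρ)
  eval-rename ρ (con a) x = ≡.refl
  eval-rename ρ (var j) x = ≡.refl
  eval-rename ρ (p ⊕ q) x = ≡.cong₂ _+_ (eval-rename ρ p x) (eval-rename ρ q x)
  eval-rename ρ (p ⊗ q) x = ≡.cong₂ _*_ (eval-rename ρ p x) (eval-rename ρ q x)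
  eval-rename ρ (⊝ p)   x = ≡.cong -_ (eval-rename ρ p x)

  ∂-rename : ∀ {m n} (ρ : Fin m → Fin n) i' i → (∀ j → δ i' (ρ j) ≡ δ i j) →
             (p : Pol m) → ∂ i' (rename ρ p) ≡ rename ρ (∂ i p)
  ∂-rename ρ i' i ρ-δ (con a) = ≡.refl
  ∂-rename ρ i' i ρ-δ (var j) = ≡.cong con (ρ-δ j)
  ∂-rename ρ i' i ρ-δ (p ⊕ q) = ≡.cong₂ _⊕_ (∂-rename ρ i' i ρ-δ p) (∂-rename ρ i' i ρ-δ q)
  ∂-rename ρ i' i ρ-δ (p ⊗ q) =
    ≡.cong₂ _⊕_ (≡.cong (_⊗ rename ρ q) (∂-rename ρ i' i ρ-δ p))
                (≡.cong (rename ρ p ⊗_) (∂-rename ρ i' i ρ-δ q))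
  ∂-rename ρ i' i ρ-δ (⊝ p)   = ≡.cong ⊝_ (∂-rename ρ i' i ρ-δ p)

  eval-∂-rename : ∀ {m n} (ρ : Fin m → Fin n) i' i → (∀ j → δ i' (ρ j) ≡ δ i j) →
                  (p : Pol m) (x : Fin n → Carrier) →
                  eval (∂ i' (rename ρ p)) x ≡ eval (∂ i p) (x ∘ ρ)
  eval-∂-rename ρ i' i ρ-δ p x =
    ≡.trans (≡.cong (λ q → eval q x) (∂-rename ρ i' i ρ-δ p)) (eval-rename ρ (∂ i p) x)

  eval-∂-rename-fresh : ∀ {m n} (ρ : Fin m → Fin n) i' → (∀ j → δ i' (ρ j) ≡ 0#) →
                        (p : Pol m) (x : Fin n → Carrier) → eval (∂ i' (rename ρ p)) x ≈ 0#
  eval-∂-rename-fresh ρ i' fresh (con a) x = refl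
  eval-∂-rename-fresh ρ i' fresh (var j) x = reflexive (fresh j)
  eval-∂-rename-fresh ρ i' fresh (p ⊕ q) x =
    trans (+-cong (eval-∂-rename-fresh ρ i' fresh p x) (eval-∂-rename-fresh ρ i' fresh q x))
          (+-identityʳ 0#)
  eval-∂-rename-fresh ρ i' fresh (p ⊗ q) x =
    trans (+-cong (trans (*-congʳ (eval-∂-rename-fresh ρ i' fresh p x)) (zeroˡ _))
                  (trans (*-congˡ (eval-∂-rename-fresh ρ i' fresh q x)) (zeroʳ _)))
          (+-identityʳ 0#)
  eval-∂-rename-fresh ρ i' fresh (⊝ p) x =
    trans (-‿cong (eval-∂-rename-fresh ρ i' fresh p x)) -0#≈0#

-- Finite fields.  Equality with 0 is not decidable here, so "some entry is nonzero"
-- is replaced by a ring element built from Fermat's little theorem.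
module FiniteFieldFacts {c ℓ : Level} (R : CommutativeRing c ℓ) (F : IsFiniteField R) where
  open CommutativeRing R hiding (zero)
  open IsFiniteField F
  open RingFacts R
  open import Algebra.Properties.Ring ring using (x[y-z]≈xy-xz; -0#≈0#; x∙y⁻¹≈ε⇒x≈y; +-identityʳ-unique)
  open import Algebra.Properties.Semiring.Exp semiring using (_^_; ^-homo-*; ^-congʳ)
  open import Relation.Binary.Reasoning.Setoid setoid

  ^-period : ∀ {u} d → u ^ d ≈ 1# → ∀ k → u ^ (k ℕ.* d) ≈ 1#
  ^-period d uᵈ≈1 ℕ.zero = refl
  ^-period {u} d uᵈ≈1 (suc k) = begin
    u ^ (d ℕ.+ k ℕ.* d)     ≈⟨ ^-homo-* u d (k ℕ.* d) ⟩
    u ^ d * u ^ (k ℕ.* d)   ≈⟨ *-cong uᵈ≈1 (^-period d uᵈ≈1 k) ⟩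
    1# * 1#                 ≈⟨ *-identityˡ 1# ⟩
    1#                      ∎

  unit-pow-cancel : ∀ {u v x} → u * v ≈ 1# → ∀ i → u ^ i * x ≈ u ^ i → x ≈ 1#
  unit-pow-cancel uv≈1 ℕ.zero eq = trans (sym (*-identityˡ _)) eq
  unit-pow-cancel {u} {x = x} uv≈1 (suc i) eq =
    unit-pow-cancel uv≈1 i (unit-cancel uv≈1 (trans (sym (*-assoc u (u ^ i) x)) eq))

  -- pigeonhole on u⁰,…,u^size: a unit has a period 1 ≤ d ≤ size
  unit-period : ∀ {u v} → u * v ≈ 1# → ∃ λ d → 1 ≤ d × d ≤ size × u ^ d ≈ 1#
  unit-period {u} uv≈1
    with Fin.pigeonhole (ℕ.n<1+n size) (λ i → proj₁ (enum-onto (u ^ Fin.toℕ i)))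
  ... | i , j , i<j , same-index = j′ ∸ i′ , ℕ.m<n⇒0<n∸m i<j , d≤size , uᵈ≈1
    where
    i′ j′ : ℕ
    i′ = Fin.toℕ i
    j′ = Fin.toℕ j
    uⁱ≈uʲ : u ^ i′ ≈ u ^ j′
    uⁱ≈uʲ = trans (sym (proj₂ (enum-onto (u ^ i′))))
                  (trans (reflexive (≡.cong enum same-index)) (proj₂ (enum-onto (u ^ j′))))
    d≤size : j′ ∸ i′ ≤ size
    d≤size = ℕ.≤-trans (ℕ.m∸n≤m j′ i′) (ℕ.≤-pred (Fin.toℕ<n j))
    uᵈ≈1 : u ^ (j′ ∸ i′) ≈ 1#
    uᵈ≈1 = unit-pow-cancel uv≈1 i′ (begin
      u ^ i′ * u ^ (j′ ∸ i′)  ≈⟨ ^-homo-* u i′ (j′ ∸ i′) ⟨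
      u ^ (i′ ℕ.+ (j′ ∸ i′))  ≈⟨ ^-congʳ u (ℕ.m+[n∸m]≡n (ℕ.<⇒≤ i<j)) ⟩
      u ^ j′                  ≈⟨ uⁱ≈uʲ ⟨
      u ^ i′                  ∎)

  -- a universal exponent for the units of F
  order : ℕ
  order = size !

  -- Fermat's little theorem: u^order = 1 for every unit u, as its period divides size!
  fermat : ∀ {u v} → u * v ≈ 1# → u ^ order ≈ 1#
  fermat {u} uv≈1 with unit-period uv≈1
  ... | suc k , _ , d≤size , uᵈ≈1
    with ∣-trans (m∣m*n (k !)) (m≤n⇒m!∣n! d≤size)
  ...   | divides q order≡q*d = trans (^-congʳ u order≡q*d) (^-period (suc k) uᵈ≈1 q)

  -- χ x = 1 − x^order is 0 at units and acts as 1 on the annihilator of x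
  χ : Carrier → Carrier
  χ x = 1# - x ^ order

  χ-unit : ∀ {x v} → x * v ≈ 1# → χ x ≈ 0#
  χ-unit xv≈1 = trans (+-congˡ (-‿cong (fermat xv≈1))) (-‿inverseʳ 1#)

  annihilates-powers : ∀ {a x} → a * x ≈ 0# → ∀ n → 0 ℕ.< n → a * x ^ n ≈ 0#
  annihilates-powers {a} {x} ax≈0 (suc n) _ =
    trans (sym (*-assoc a x (x ^ n))) (trans (*-congʳ ax≈0) (zeroˡ _))

  χ-annihilator : ∀ {a x} → a * x ≈ 0# → a * χ x ≈ a
  χ-annihilator {a} {x} ax≈0 = begin
    a * (1# - x ^ order)       ≈⟨ x[y-z]≈xy-xz a 1# (x ^ order) ⟩
    a * 1# - a * x ^ order     ≈⟨ +-cong (*-identityʳ a) (-‿cong axᵒ≈0) ⟩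
    a - 0#                     ≈⟨ +-congˡ -0#≈0# ⟩
    a + 0#                     ≈⟨ +-identityʳ a ⟩
    a                          ∎
    where
    axᵒ≈0 : a * x ^ order ≈ 0#
    axᵒ≈0 = annihilates-powers ax≈0 order (ℕ.>-nonZero⁻¹ order {{size ℕ.!≢0}})

  -- allZero h = ∏ⱼ χ(h j): vanishes once some entry is a unit, acts as 1 on the
  -- common annihilator of the entries
  allZero : ∀ {k} → (Fin k → Carrier) → Carrier
  allZero {ℕ.zero} h = 1#
  allZero {suc k}  h = χ (h zero) * allZero (h ∘ suc)

  allZero-unit : ∀ {k} (h : Fin k → Carrier) j {v} → h j * v ≈ 1# → allZero h ≈ 0#
  allZero-unit h zero    hv≈1 = trans (*-congʳ (χ-unit hv≈1)) (zeroˡ _)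
  allZero-unit h (suc j) hv≈1 = trans (*-congˡ (allZero-unit (h ∘ suc) j hv≈1)) (zeroʳ _)

  allZero-annihilator : ∀ {k} (h : Fin k → Carrier) {a} → (∀ j → a * h j ≈ 0#) → a * allZero h ≈ a
  allZero-annihilator {ℕ.zero} h ah≈0 = *-identityʳ _
  allZero-annihilator {suc k}  h {a} ah≈0 = begin
    a * (χ (h zero) * allZero (h ∘ suc))  ≈⟨ *-assoc a _ _ ⟨
    (a * χ (h zero)) * allZero (h ∘ suc)  ≈⟨ *-congʳ (χ-annihilator (ah≈0 zero)) ⟩
    a * allZero (h ∘ suc)                 ≈⟨ allZero-annihilator (h ∘ suc) (ah≈0 ∘ suc) ⟩
    a                                     ∎

  ¬¬-∀-Fin : ∀ {p k} (Q : Fin k → Set p) → (∀ j → ¬ ¬ Q j) → ¬ ¬ (∀ j → Q j)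
  ¬¬-∀-Fin {k = ℕ.zero} Q ¬¬Q ¬∀Q = ¬∀Q λ ()
  ¬¬-∀-Fin {k = suc k}  Q ¬¬Q ¬∀Q = ¬¬Q zero λ Q₀ →
    ¬¬-∀-Fin (Q ∘ suc) (¬¬Q ∘ suc) λ Qₛ → ¬∀Q λ { zero → Q₀ ; (suc j) → Qₛ j }

  -- if h is not identically zero then allZero h ≠ 1: each entry is ¬¬-zero otherwise
  allZero≉1 : ∀ {k} (h : Fin k → Carrier) → ¬ (∀ j → h j ≈ 0#) → ¬ (allZero h ≈ 1#)
  allZero≉1 h h≢0 allZero≈1 = ¬¬-∀-Fin (λ j → h j ≈ 0#) ¬¬zero h≢0
    where
    ¬¬zero : ∀ j → ¬ ¬ (h j ≈ 0#)
    ¬¬zero j hⱼ≉0 with inverse (h j) hⱼ≉0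
    ... | v , hv≈1 = 0≉1 (trans (sym (allZero-unit h j hv≈1)) allZero≈1)

  annihilator-of-nonzero : ∀ {k} (h : Fin k → Carrier) a →
    (∀ j → a * h j ≈ 0#) → ¬ (∀ j → h j ≈ 0#) → a ≈ 0#
  annihilator-of-nonzero h a ah≈0 h≢0 with inverse (1# - allZero h) 1-allZero≉0
    where
    1-allZero≉0 : ¬ (1# - allZero h ≈ 0#)
    1-allZero≉0 eq = allZero≉1 h h≢0 (sym (x∙y⁻¹≈ε⇒x≈y 1# (allZero h) eq))
  ... | v , zv≈1 = unit-annihilator zv≈1 (begin
    a * (1# - allZero h)        ≈⟨ x[y-z]≈xy-xz a 1# (allZero h) ⟩
    a * 1# - a * allZero h      ≈⟨ +-cong (*-identityʳ a) (-‿cong (allZero-annihilator h ah≈0)) ⟩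
    a - a                       ≈⟨ -‿inverseʳ a ⟩
    0#                          ∎)

  independent-by-minors : ∀ {n} (u v : Fin (suc n) → Carrier) (μ : Fin n → Carrier) {v₀⁻¹} →
    v zero * v₀⁻¹ ≈ 1# →
    (∀ j → u (suc j) * v zero ≈ u zero * v (suc j) + μ j) →
    ¬ (∀ j → μ j ≈ 0#) →
    ∀ a b → (∀ i → a * u i + b * v i ≈ 0#) → (a ≈ 0#) × (b ≈ 0#)
  independent-by-minors u v μ v₀-unit minor μ≢0 a b comb = a≈0 , b≈0
    where
    aμ≈0 : ∀ j → a * μ j ≈ 0#
    aμ≈0 j = +-identityʳ-unique (a * (u zero * v (suc j))) (a * μ j) (begin
      a * (u zero * v (suc j)) + a * μ j  ≈⟨ distribˡ a _ _ ⟨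
      a * (u zero * v (suc j) + μ j)      ≈⟨ *-congˡ (minor j) ⟨
      a * (u (suc j) * v zero)            ≈⟨ cross-multiply a b u v comb (suc j) zero ⟩
      a * (u zero * v (suc j))            ∎)
    a≈0 : a ≈ 0#
    a≈0 = annihilator-of-nonzero μ a aμ≈0 μ≢0
    b≈0 : b ≈ 0#
    b≈0 = unit-annihilator v₀-unit (begin
      b * v zero                 ≈⟨ +-identityˡ _ ⟨
      0# + b * v zero            ≈⟨ +-congʳ (trans (*-congʳ a≈0) (zeroˡ _)) ⟨
      a * u zero + b * v zero    ≈⟨ comb zero ⟩
      0#                         ∎)

module LiftedPoint {c ℓ : Level} (R : CommutativeRing c ℓ) {m : ℕ}
  (a₂ b₂ : Fin m → Fin m → CommutativeRing.Carrier R)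
  (c₃ : Fin (suc m) → Fin (suc m) → Fin (suc m) → CommutativeRing.Carrier R)
  (y : Fin (suc m) → CommutativeRing.Carrier R) (w : CommutativeRing.Carrier R)
  where
  open CommutativeRing R hiding (zero)
  open Poly R
  open Setup a₂ b₂ c₃
  open PolyCalculus R
  open RingFacts R
  open import Algebra.Properties.Ring ring
    using (-0#≈0#; -‿distribˡ-*; -‿distribʳ-*; x∙y⁻¹≈ε⇒x≈y; +-inverseˡ-unique)
  open import Relation.Binary.Reasoning.Setoid setoid
  open NaturalCoefficientSolver commutativeSemiring using (solve; _:+_; _:*_; _:=_)

  P : Fin (suc (suc m)) → Carrier
  P = liftPoint y w

  Y t : Carrier
  Y = y zero
  z : Fin m → Carrier
  z = y ∘ suc
  F₂ G₂ F₃ : Carrier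
  F₂ = eval f₂ z
  G₂ = eval g₂ z
  F₃ = eval f₃ y
  t = - (w * G₂)

  ∂F₂ ∂G₂ : Fin m → Carrier
  ∂F₂ i = eval (∂ i f₂) z
  ∂G₂ i = eval (∂ i g₂) z
  ∂F₃ : Fin (suc m) → Carrier
  ∂F₃ j = eval (∂ j f₃) y

  up : Fin m → Fin (suc (suc m))
  up i = suc (suc i)

  f-at : eval f P ≈ t * F₂ + F₃
  f-at = reflexive (≡.cong₂ _+_ (≡.cong (t *_) (eval-rename up f₂ P)) (eval-rename suc f₃ P))

  g-at : eval g P ≈ t * Y + G₂
  g-at = reflexive (≡.cong (t * Y +_) (eval-rename up g₂ P))

  H-at : eval H y ≈ Y * F₃ - F₂ * G₂
  H-at = reflexive (≡.cong (λ e → Y * F₃ - e)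
                           (≡.cong₂ _*_ (eval-rename suc f₂ y) (eval-rename suc g₂ y)))

  -- the partial derivatives, each obtained by dropping the terms renamed away from the variable
  ∂₀f-at : eval (∂ zero f) P ≈ F₂
  ∂₀f-at = begin
    (1# * eval (rename up f₂) P + t * eval (∂ zero (rename up f₂)) P)
      + eval (∂ zero (rename suc f₃)) P
        ≈⟨ +-cong (+-cong (*-identityˡ _) (*-congˡ (eval-∂-rename-fresh up zero (λ _ → ≡.refl) f₂ P)))
                  (eval-∂-rename-fresh suc zero (λ _ → ≡.refl) f₃ P) ⟩
    (eval (rename up f₂) P + t * 0#) + 0#
        ≈⟨ trans (+-identityʳ _) (+-congˡ (zeroʳ t)) ⟩
    eval (rename up f₂) P + 0#
        ≈⟨ trans (+-identityʳ _) (reflexive (eval-rename up f₂ P)) ⟩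
    F₂  ∎

  ∂₁f-at : eval (∂ (suc zero) f) P ≈ ∂F₃ zero
  ∂₁f-at = begin
    (0# * eval (rename up f₂) P + t * eval (∂ (suc zero) (rename up f₂)) P)
      + eval (∂ (suc zero) (rename suc f₃)) P
        ≈⟨ +-cong (+-cong (zeroˡ _) (*-congˡ (eval-∂-rename-fresh up (suc zero) (λ _ → ≡.refl) f₂ P)))
                  (reflexive (eval-∂-rename suc (suc zero) zero (λ _ → ≡.refl) f₃ P)) ⟩
    (0# + t * 0#) + ∂F₃ zero
        ≈⟨ +-congʳ (trans (+-identityˡ _) (zeroʳ t)) ⟩
    0# + ∂F₃ zero
        ≈⟨ +-identityˡ _ ⟩
    ∂F₃ zero  ∎

  ∂ₛf-at : ∀ i → eval (∂ (up i) f) P ≈ t * ∂F₂ i + ∂F₃ (suc i)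
  ∂ₛf-at i = begin
    (0# * eval (rename up f₂) P + t * eval (∂ (up i) (rename up f₂)) P)
      + eval (∂ (up i) (rename suc f₃)) P
        ≈⟨ +-cong (+-cong (zeroˡ _) (*-congˡ (reflexive (eval-∂-rename up (up i) i (λ _ → ≡.refl) f₂ P))))
                  (reflexive (eval-∂-rename suc (up i) (suc i) (λ _ → ≡.refl) f₃ P)) ⟩
    (0# + t * ∂F₂ i) + ∂F₃ (suc i)
        ≈⟨ +-congʳ (+-identityˡ _) ⟩
    t * ∂F₂ i + ∂F₃ (suc i)  ∎

  ∂₀g-at : eval (∂ zero g) P ≈ Y
  ∂₀g-at = begin
    (1# * Y + t * 0#) + eval (∂ zero (rename up g₂)) P
        ≈⟨ +-cong (+-cong (*-identityˡ Y) (zeroʳ t)) (eval-∂-rename-fresh up zero (λ _ → ≡.refl) g₂ P) ⟩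
    (Y + 0#) + 0#
        ≈⟨ trans (+-identityʳ _) (+-identityʳ Y) ⟩
    Y  ∎

  ∂₁g-at : eval (∂ (suc zero) g) P ≈ t
  ∂₁g-at = begin
    (0# * Y + t * 1#) + eval (∂ (suc zero) (rename up g₂)) P
        ≈⟨ +-cong (+-cong (zeroˡ Y) (*-identityʳ t))
                  (eval-∂-rename-fresh up (suc zero) (λ _ → ≡.refl) g₂ P) ⟩
    (0# + t) + 0#
        ≈⟨ trans (+-identityʳ _) (+-identityˡ t) ⟩
    t  ∎

  ∂ₛg-at : ∀ i → eval (∂ (up i) g) P ≈ ∂G₂ i
  ∂ₛg-at i = begin
    (0# * Y + t * 0#) + eval (∂ (up i) (rename up g₂)) P
        ≈⟨ +-cong (+-cong (zeroˡ Y) (zeroʳ t)) (reflexive (eval-∂-rename up (up i) i (λ _ → ≡.refl) g₂ P)) ⟩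
    (0# + 0#) + ∂G₂ i
        ≈⟨ trans (+-congʳ (+-identityʳ 0#)) (+-identityˡ _) ⟩
    ∂G₂ i  ∎

  ∂₀H-at : eval (∂ zero H) y ≈ F₃ + Y * ∂F₃ zero
  ∂₀H-at = begin
    (1# * F₃ + Y * ∂F₃ zero)
      + - (eval (∂ zero (rename suc f₂)) y * eval (rename suc g₂) y
           + eval (rename suc f₂) y * eval (∂ zero (rename suc g₂)) y)
        ≈⟨ +-cong (+-congʳ (*-identityˡ F₃))
                  (-‿cong (+-cong (*-congʳ (eval-∂-rename-fresh suc zero (λ _ → ≡.refl) f₂ y))
                                  (*-congˡ (eval-∂-rename-fresh suc zero (λ _ → ≡.refl) g₂ y)))) ⟩
    (F₃ + Y * ∂F₃ zero) + - (0# * eval (rename suc g₂) y + eval (rename suc f₂) y * 0#)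
        ≈⟨ +-congˡ (-‿cong (trans (+-cong (zeroˡ _) (zeroʳ _)) (+-identityʳ 0#))) ⟩
    (F₃ + Y * ∂F₃ zero) + - 0#
        ≈⟨ trans (+-congˡ -0#≈0#) (+-identityʳ _) ⟩
    F₃ + Y * ∂F₃ zero  ∎

  ∂ₛH-at : ∀ i → eval (∂ (suc i) H) y ≈ Y * ∂F₃ (suc i) + - (∂F₂ i * G₂ + F₂ * ∂G₂ i)
  ∂ₛH-at i = +-cong
    (trans (+-congʳ (zeroˡ F₃)) (+-identityˡ _))
    (-‿cong (+-cong (*-cong (reflexive (eval-∂-rename suc (suc i) i (λ _ → ≡.refl) f₂ y))
                            (reflexive (eval-rename suc g₂ y)))
                    (*-cong (reflexive (eval-rename suc f₂ y))
                            (reflexive (eval-∂-rename suc (suc i) i (λ _ → ≡.refl) g₂ y)))))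

  module OnZeroOfH (Yw≈1 : Y * w ≈ 1#) (H≈0 : eval H y ≈ 0#) where

    negated-summand : ∀ x u → - x * u + x * u ≈ 0#
    negated-summand x u = trans (+-congʳ (sym (-‿distribˡ-* x u))) (-‿inverseˡ (x * u))

    f-vanishes : eval f P ≈ 0#
    f-vanishes = begin
      eval f P                      ≈⟨ f-at ⟩
      t * F₂ + F₃                   ≈⟨ +-congˡ F₃≈wG₂F₂ ⟩
      - (w * G₂) * F₂ + w * G₂ * F₂ ≈⟨ negated-summand (w * G₂) F₂ ⟩
      0#                            ∎
      where
      F₃≈wG₂F₂ : F₃ ≈ w * G₂ * F₂
      F₃≈wG₂F₂ = begin
        F₃              ≈⟨ inverse-cancels Yw≈1 F₃ ⟨
        w * (Y * F₃)    ≈⟨ *-congˡ (x∙y⁻¹≈ε⇒x≈y (Y * F₃) (F₂ * G₂) (trans (sym H-at) H≈0)) ⟩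
        w * (F₂ * G₂)   ≈⟨ solve 3 (λ w f g → w :* (f :* g) := w :* g :* f) refl w F₂ G₂ ⟩
        w * G₂ * F₂     ∎

    g-vanishes : eval g P ≈ 0#
    g-vanishes = begin
      eval g P                      ≈⟨ g-at ⟩
      t * Y + G₂                    ≈⟨ +-congˡ G₂≈wG₂Y ⟩
      - (w * G₂) * Y + w * G₂ * Y   ≈⟨ negated-summand (w * G₂) Y ⟩
      0#                            ∎
      where
      G₂≈wG₂Y : G₂ ≈ w * G₂ * Y
      G₂≈wG₂Y = begin
        G₂             ≈⟨ inverse-cancels Yw≈1 G₂ ⟨
        w * (Y * G₂)   ≈⟨ solve 3 (λ w y g → w :* (y :* g) := w :* g :* y) refl w Y G₂ ⟩
        w * G₂ * Y     ∎

    minor : ∀ j → eval (∂ (suc j) f) P * eval (∂ zero g) P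
                    ≈ eval (∂ zero f) P * eval (∂ (suc j) g) P + eval (∂ j H) y
    minor zero = begin
      eval (∂ (suc zero) f) P * eval (∂ zero g) P    ≈⟨ *-cong ∂₁f-at ∂₀g-at ⟩
      d * Y                                          ≈⟨ +-identityˡ _ ⟨
      0# + d * Y                                     ≈⟨ +-congʳ (trans (sym f-at) f-vanishes) ⟨
      (t * F₂ + F₃) + d * Y                          ≈⟨ solve 5 (λ t f g d y → t :* f :+ g :+ d :* y := f :* t :+ (g :+ y :* d))
                                                              refl t F₂ F₃ d Y ⟩
      F₂ * t + (F₃ + Y * d)                          ≈⟨ +-cong (*-cong ∂₀f-at ∂₁g-at) ∂₀H-at ⟨
      eval (∂ zero f) P * eval (∂ (suc zero) g) P + eval (∂ zero H) y  ∎
      where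
      d = ∂F₃ zero
    minor (suc i) = begin
      eval (∂ (up i) f) P * eval (∂ zero g) P        ≈⟨ *-cong (∂ₛf-at i) ∂₀g-at ⟩
      (t * p + d) * Y                                ≈⟨ solve 4 (λ t p d y → (t :* p :+ d) :* y := p :* (t :* y) :+ y :* d)
                                                              refl t p d Y ⟩
      p * (t * Y) + Y * d                            ≈⟨ +-congʳ (*-congˡ tY≈-G₂) ⟩
      p * - G₂ + Y * d                               ≈⟨ +-congʳ (-‿distribʳ-* p G₂) ⟨
      - (p * G₂) + Y * d                             ≈⟨ +-comm _ _ ⟩
      Y * d + - (p * G₂)                             ≈⟨ +-cancel-inner (F₂ * q) (Y * d) (p * G₂) ⟨
      F₂ * q + (Y * d + - (p * G₂ + F₂ * q))         ≈⟨ +-cong (*-cong ∂₀f-at (∂ₛg-at i)) (∂ₛH-at i) ⟨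
      eval (∂ zero f) P * eval (∂ (up i) g) P + eval (∂ (suc i) H) y  ∎
      where
      p = ∂F₂ i
      q = ∂G₂ i
      d = ∂F₃ (suc i)
      tY≈-G₂ : t * Y ≈ - G₂
      tY≈-G₂ = +-inverseˡ-unique (t * Y) G₂ (trans (sym g-at) g-vanishes)

lemma11 : ∀ {c ℓ : Level} (R : CommutativeRing c ℓ) → IsFiniteField R →
  let open CommutativeRing R hiding (zero)
      open Poly R
  in ∀ (m : ℕ) → 1 ≤ m →
     ∀ (a₂ b₂ : Fin m → Fin m → Carrier)
       (c₃ : Fin (suc m) → Fin (suc m) → Fin (suc m) → Carrier) →
     let open Setup a₂ b₂ c₃ in
     ∀ (y : Fin (suc m) → Carrier) →
       eval H y ≈ 0# → ¬ GradZero H y → ¬ (y zero ≈ 0#) →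
     ∀ (y₂⁻¹ : Carrier) → y zero * y₂⁻¹ ≈ 1# →
     (eval f (liftPoint y y₂⁻¹) ≈ 0#) × (eval g (liftPoint y y₂⁻¹) ≈ 0#)
       × GradsIndependent f g (liftPoint y y₂⁻¹)
lemma11 R isFiniteField m _ a₂ b₂ c₃ y H≈0 ∇H≢0 _ y₂⁻¹ Yw≈1 =
  f-vanishes , g-vanishes ,
  independent-by-minors (λ i → eval (∂ i f) P) (λ i → eval (∂ i g) P) (λ j → eval (∂ j H) y)
                        (trans (*-congʳ ∂₀g-at) Yw≈1) minor ∇H≢0
  where
  open CommutativeRing R hiding (zero)
  open Poly R
  open Setup a₂ b₂ c₃
  open LiftedPoint R a₂ b₂ c₃ y y₂⁻¹
  open OnZeroOfH Yw≈1 H≈0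
  open FiniteFieldFacts R isFiniteField using (independent-by-minors)
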